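{- Let $n$ be a positive integer. Then the $n$-th OR-power $[M(K_n)\setminus\{z\}]^n$ contains a clique of size $n^n$ each of whose vertices (a sequence of length $n$) has at least one coordinate belonging to $V(K_n)\times\{1\}$.
   Context: $K_n$ is the complete graph on $n$ vertices. The Mycielskian $M(G)$ of a simple graph $G$ has vertex set $V(G)\times\{0,1\}\cup\{z\}$ ($z$ a new vertex) and edge set $\{\{(v,0),(w,i)\}:\{v,w\}\in E(G),\ i\in\{0,1\}\}\cup\{\{z,(v,1)\}: v\in V(G)\}$; $M(K_n)\setminus\{z\}$ is the graph obtained by deleting $z$. For a graph $H$, $H^t$ is its $t$-fold OR-power: vertex set $V(H)^t$, two distinct sequences adjacent iff in at least one coordinate their entries are adjacent in $H$. -}

module Defs where

open import Level using (0ℓ)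
open import Data.Nat using (ℕ; _^_)
open import Data.Fin using (Fin)
open import Data.Bool using (Bool; true; false)
open import Data.Product using (_×_; _,_; ∃-syntax; proj₂)
open import Data.Sum using (_⊎_)
open import Relation.Binary.PropositionalEquality using (_≡_; _≢_)
open import Relation.Nullary using (¬_)

record Graph : Set₁ where
  field
    V   : Set
    Adj : V → V → Set
open Graph public

K : ℕ → Graph
K n = record { V = Fin n ; Adj = λ v w → v ≢ w }

-- Layer of the Mycielskian: false = layer 0, true = layer 1.
-- M(G) \ {z}: vertex set V(G) × {0,1}; (v,i) ~ (w,j) iff vw ∈ E(G) and
-- at least one of i, j is 0 (edges {(v,0),(w,i)} taken as unordered pairs).
MycielskiMinusZ : Graph → Graph
MycielskiMinusZ G = record
  { V   = V G × Bool
  ; Adj = λ { (v , i) (w , j) → Adj G v w × (i ≡ false ⊎ j ≡ false) } }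

ORPower : Graph → ℕ → Graph
ORPower H t = record
  { V   = Fin t → V H
  ; Adj = λ x y → (¬ (x ≡ y)) × (∃[ k ] Adj H (x k) (y k)) }

record Clique (H : Graph) (m : ℕ) : Set where
  field
    vertex    : Fin m → V H
    injective : ∀ a b → vertex a ≡ vertex b → a ≡ b
    adjacent  : ∀ a b → a ≢ b → Adj H (vertex a) (vertex b)
open Clique public

-- A clique in the OR-power is a family of sequences in which any two distinct
-- members differ at some coordinate that is in layer 0 for one of them.  Take all
-- n^n sequences f : Fin n → Fin n and put f in layer 1 exactly at the coordinate
-- (Σ f) mod n.  If f ≠ g differ only at coordinates where both are in layer 1,
-- they differ at a single coordinate k = (Σ f) mod n = (Σ g) mod n; but changing
-- one entry by less than n changes the sum mod n, a contradiction.
module Submission where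

open import Defs
open import Data.Nat using (ℕ; zero; suc; _+_; _*_; _^_; _<_; NonZero)
open import Data.Nat.Properties using (+-assoc; *-comm; +-0-commutativeMonoid)
open import Data.Nat.DivMod using (_%_; %-distribˡ-+; [m+kn]%n≡m%n; m<n⇒m%n≡m; m%n<n)
open import Data.Fin using (Fin; toℕ; fromℕ<; finToFun; funToFin; combine; punchIn)
open import Data.Fin.Properties
  using (_≟_; all?; ¬∀⟶∃¬; funToFin-finToFin; toℕ-injective; toℕ-fromℕ<; toℕ<n; punchInᵢ≢i)
open import Data.Bool using (true)
open import Data.Product using (Σ; _,_; ∃-syntax; proj₁; proj₂)
open import Data.Sum using (_⊎_; inj₁; inj₂; [_,_])
open import Function using (_∘_; id)
open import Relation.Nullary using (¬_; Dec; does; yes; no; contradiction)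
open import Relation.Nullary.Decidable using (_⊎-dec_; dec-true; dec-false)
open import Relation.Binary.PropositionalEquality
  using (_≡_; _≢_; _≗_; refl; cong; cong₂; module ≡-Reasoning)
open import Algebra.Properties.CommutativeMonoid.Sum +-0-commutativeMonoid using (sum; sum-remove; sum-cong-≗)
open ≡-Reasoning

%-congʳ-+ : ∀ a b c d .{{_ : NonZero d}} → a % d ≡ b % d → (a + c) % d ≡ (b + c) % d
%-congʳ-+ a b c d eq = begin
  (a + c) % d          ≡⟨ %-distribˡ-+ a c d ⟩
  (a % d + c % d) % d  ≡⟨ cong (λ r → (r + c % d) % d) eq ⟩
  (b % d + c % d) % d  ≡⟨ %-distribˡ-+ b c d ⟨
  (b + c) % d          ∎

-- Adding d * r to x + r gives x + r * suc d, which undoes the shift by r.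
%-cancelʳ-+ : ∀ {x y} r d → x < suc d → y < suc d →
              (x + r) % suc d ≡ (y + r) % suc d → x ≡ y
%-cancelʳ-+ {x} {y} r d x<n y<n eq = begin
  x                            ≡⟨ unshift x x<n ⟩
  (x + r + d * r) % suc d      ≡⟨ %-congʳ-+ (x + r) (y + r) (d * r) (suc d) eq ⟩
  (y + r + d * r) % suc d      ≡⟨ unshift y y<n ⟨
  y                            ∎
  where
  unshift : ∀ z → z < suc d → z ≡ (z + r + d * r) % suc d
  unshift z z<n = begin
    z                          ≡⟨ m<n⇒m%n≡m z<n ⟨
    z % suc d                  ≡⟨ [m+kn]%n≡m%n z r (suc d) ⟨
    (z + r * suc d) % suc d    ≡⟨ cong (λ s → (z + s) % suc d) (*-comm r (suc d)) ⟩
    (z + (r + d * r)) % suc d  ≡⟨ cong (_% suc d) (+-assoc z r (d * r)) ⟨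
    (z + r + d * r) % suc d    ∎

funToFin-cong : ∀ {m n} {f g : Fin m → Fin n} → f ≗ g → funToFin f ≡ funToFin g
funToFin-cong {zero}  f≗g = refl
funToFin-cong {suc m} f≗g = cong₂ combine (f≗g Fin.zero) (funToFin-cong (f≗g ∘ Fin.suc))

finToFun-injective : ∀ {m n} {a b : Fin (n ^ m)} → finToFun {n} {m} a ≗ finToFun b → a ≡ b
finToFun-injective {m} {n} {a} {b} eq = begin
  a                               ≡⟨ funToFin-finToFin {m} {n} a ⟨
  funToFin (finToFun {n} {m} a)   ≡⟨ funToFin-cong eq ⟩
  funToFin (finToFun {n} {m} b)   ≡⟨ funToFin-finToFin {m} {n} b ⟩
  b                               ∎

AgreeOff : ∀ {t m} → Fin t → (Fin t → Fin m) → (Fin t → Fin m) → Set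
AgreeOff k f g = ∀ j → j ≡ k ⊎ f j ≡ g j

InjectiveOnLines : ∀ {t m} → ((Fin t → Fin m) → Fin t) → Set
InjectiveOnLines μ = ∀ f g k → AgreeOff k f g → μ f ≡ μ g → f k ≡ g k

agreeOff? : ∀ {t m} k (f g : Fin t → Fin m) j → Dec (j ≡ k ⊎ f j ≡ g j)
agreeOff? k f g j = (j ≟ k) ⊎-dec (f j ≟ g j)

module Marking {t m : ℕ} (μ : (Fin t → Fin m) → Fin t) where

  mark : (Fin t → Fin m) → V (ORPower (MycielskiMinusZ (K m)) t)
  mark f k = f k , does (k ≟ μ f)

  mark-layer₁ : ∀ f → proj₂ (mark f (μ f)) ≡ true
  mark-layer₁ f = dec-true (μ f ≟ μ f) refl

  mark-injective : ∀ {f g} → mark f ≡ mark g → f ≗ g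
  mark-injective e k = cong (λ x → proj₁ (x k)) e

  mark-adjacent : InjectiveOnLines μ → ∀ f g → ¬ f ≗ g →
                  ∃[ k ] Adj (MycielskiMinusZ (K m)) (mark f k) (mark g k)
  mark-adjacent injective f g f≉g with all? (agreeOff? (μ f) f g)
  ... | no ¬agree with ¬∀⟶∃¬ t _ (agreeOff? (μ f) f g) ¬agree
  ...   | j , ¬p = j , ¬p ∘ inj₂ , inj₁ (dec-false (j ≟ μ f) (¬p ∘ inj₁))
  mark-adjacent injective f g f≉g | yes agree =
    μ f , differ , inj₂ (dec-false (μ f ≟ μ g) (differ ∘ injective f g (μ f) agree))
    where
    differ : f (μ f) ≢ g (μ f)
    differ e = f≉g (λ j → [ (λ { refl → e }) , id ] (agree j))

  markedClique : InjectiveOnLines μ → Clique (ORPower (MycielskiMinusZ (K m)) t) (m ^ t)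
  markedClique injective = record
    { vertex    = mark ∘ finToFun {m} {t}
    ; injective = λ a b → finToFun-injective {t} {m} ∘ mark-injective
    ; adjacent  = λ a b a≢b →
        let f≉g = a≢b ∘ finToFun-injective {t} {m} in
        f≉g ∘ mark-injective , mark-adjacent injective (finToFun a) (finToFun b) f≉g
    }

digitSum : ∀ {n} → (Fin n → Fin n) → ℕ
digitSum f = sum (toℕ ∘ f)

digitSumMod : ∀ {d} → (Fin (suc d) → Fin (suc d)) → Fin (suc d)
digitSumMod {d} f = fromℕ< (m%n<n (digitSum f) (suc d))

digitSum-remove : ∀ {d} (f : Fin (suc d) → Fin (suc d)) k →
                  digitSum f ≡ toℕ (f k) + sum (toℕ ∘ f ∘ punchIn k)
digitSum-remove f k = sum-remove {i = k} (toℕ ∘ f)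

digitSumMod-injectiveOnLines : ∀ {d} → InjectiveOnLines (digitSumMod {d})
digitSumMod-injectiveOnLines {d} f g k agree eq =
  toℕ-injective (%-cancelʳ-+ (rest f) d (toℕ<n (f k)) (toℕ<n (g k)) (begin
    (toℕ (f k) + rest f) % suc d   ≡⟨ cong (_% suc d) (digitSum-remove f k) ⟨
    digitSum f % suc d             ≡⟨ sums≡ ⟩
    digitSum g % suc d             ≡⟨ cong (_% suc d) (digitSum-remove g k) ⟩
    (toℕ (g k) + rest g) % suc d   ≡⟨ cong (λ r → (toℕ (g k) + r) % suc d) rests≡ ⟨
    (toℕ (g k) + rest f) % suc d   ∎))
  where
  rest : (Fin (suc d) → Fin (suc d)) → ℕ
  rest h = sum (toℕ ∘ h ∘ punchIn k)

  rests≡ : rest f ≡ rest g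
  rests≡ = sum-cong-≗ λ j →
    [ (λ p → contradiction p (punchInᵢ≢i k j)) , cong toℕ ] (agree (punchIn k j))

  sums≡ : digitSum f % suc d ≡ digitSum g % suc d
  sums≡ = begin
    digitSum f % suc d        ≡⟨ toℕ-fromℕ< (m%n<n (digitSum f) (suc d)) ⟨
    toℕ (digitSumMod f)       ≡⟨ cong toℕ eq ⟩
    toℕ (digitSumMod g)       ≡⟨ toℕ-fromℕ< (m%n<n (digitSum g) (suc d)) ⟩
    digitSum g % suc d        ∎

lemma1 : (n : ℕ) → .{{_ : NonZero n}} →
    Σ (Clique (ORPower (MycielskiMinusZ (K n)) n) (n ^ n)) λ C →
      ∀ a → ∃[ k ] proj₂ (vertex C a k) ≡ true
lemma1 (suc d) =
  markedClique digitSumMod-injectiveOnLines ,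
  λ a → digitSumMod (finToFun a) , mark-layer₁ (finToFun a)
  where open Marking digitSumMod
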